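{- Let $n\geq 3$ and let $M_n=(a_{ij})_{1\leq i,j\leq n-1}$ be the $(n-1)\times(n-1)$ integer matrix with entries $$a_{ij}=\begin{cases}0, & i+j=n,\\ 2, & i+j=n-1,\\ 1, & \text{otherwise}.\end{cases}$$ (Thus row $1$ is $(1,\dots,1,2,0)$, row $2$ is $(1,\dots,1,2,0,1)$, \dots, row $n-2$ is $(2,0,1,\dots,1)$, and row $n-1$ is $(0,1,\dots,1)$.) Then $$\det M_n=(-1)^{\lfloor (n-2)/2\rfloor}\left(\binom n2-1\right).$$ -}

module Defs where

open import Data.Nat as ℕ using (ℕ; zero; suc; _∸_; _/_)
open import Data.Nat.Combinatorics using (_C_)
open import Data.Integer as ℤ using (ℤ; +_; -_; _+_; _*_; _-_)
open import Data.Bool using (if_then_else_)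
open import Data.Fin using (Fin; zero; suc; toℕ; punchIn)

Matrix : ℕ → Set
Matrix k = Fin k → Fin k → ℤ

sgn : ℕ → ℤ
sgn zero = + 1
sgn (suc k) = - sgn k

sumFin : ∀ k → (Fin k → ℤ) → ℤ
sumFin zero f = + 0
sumFin (suc k) f = f zero + sumFin k (λ j → f (suc j))

minor : ∀ {k} → Matrix (suc k) → Fin (suc k) → Fin (suc k) → Matrix k
minor A i j r c = A (punchIn i r) (punchIn j c)

det : ∀ k → Matrix k → ℤ
det zero A = + 1
det (suc k) A = sumFin (suc k) (λ j → sgn (toℕ j) * (A zero j * det k (minor A zero j)))

-- The matrix M_n, of size (n-1)×(n-1); index r : Fin (n ∸ 1) stands for
-- i = toℕ r + 1, so i + j = toℕ r + toℕ c + 2.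
entry : ℕ → ℕ → ℕ → ℤ
entry n i j =
  if i ℕ.+ j ℕ.≡ᵇ n then + 0
  else if suc (i ℕ.+ j) ℕ.≡ᵇ n then + 2
  else + 1

M : ∀ n → Matrix (n ∸ 1)
M n r c = entry n (suc (toℕ r)) (suc (toℕ c))

-- Adding to the first row a weighted sum of the other rows leaves it with a single nonzero
-- entry, and Laplace expansion along it yields a matrix of the same family. Let E_s be the
-- s × s matrix built by the rule of M with parameter s (zero where i + j = s, two where
-- i + j = s − 1). With weights 1, 2, …, n − 2 and a suitable last weight, the first row of M_n
-- becomes (C(n,2) − 1, 0, …, 0) and the remaining minor is E_{n−2}. With weights 1, …, 1, 1 − s
-- the first row of E_s becomes minus a unit row, the minor is E_{s−1}, and so
-- det E_s = (−1)^⌊s/2⌋. That the row operation preserves the cofactor-expansion determinant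
-- comes from its alternation in the first two rows.

module Submission where

open import Defs
open import Data.Nat using (ℕ; _≤_; _∸_; _/_)
open import Data.Nat.Combinatorics using (_C_)
open import Data.Integer using (ℤ; +_; _*_; _-_)
open import Relation.Binary.PropositionalEquality using (_≡_)

open import Data.Bool using (if_then_else_)
open import Data.Fin using (Fin; zero; suc; toℕ; punchIn; lift; fromℕ<)
import Data.Fin.Properties as FinP
open import Data.Integer using (_+_; -_; -[1+_])
import Data.Integer.Properties as ℤP
open import Data.Integer.Tactic.RingSolver using (solve-∀)
open import Data.Nat as ℕ using (zero; suc; _<_; z≤n; s≤s)
import Data.Nat.Combinatorics as ℕC
import Data.Nat.DivMod as ℕD
import Data.Nat.Properties as ℕP
open import Data.Product using (_,_)
open import Data.Sum using (inj₁; inj₂)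
open import Function using (_∘_)
open import Relation.Binary.Definitions using (tri<; tri≈; tri>)
open import Relation.Binary.PropositionalEquality
  using (refl; sym; trans; cong; cong₂; subst; _≗_; _≢_; module ≡-Reasoning)
open import Relation.Nullary using (contradiction)

open import Algebra.Properties.AbelianGroup ℤP.+-0-abelianGroup using (inverseʳ-unique)
open import Algebra.Properties.Semiring.Sum ℤP.+-*-semiring
  using (sum; ∑-distrib-+; ∑-comm; *-distribˡ-sum; *-distribʳ-sum)

open ≡-Reasoning

-- Finite sums

sumFin≡sum : ∀ k (f : Fin k → ℤ) → sumFin k f ≡ sum f
sumFin≡sum zero    f = refl
sumFin≡sum (suc k) f = cong (_+_ (f zero)) (sumFin≡sum k (f ∘ suc))

sumFin-cong : ∀ k {f g : Fin k → ℤ} → f ≗ g → sumFin k f ≡ sumFin k g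
sumFin-cong zero    f≗g = refl
sumFin-cong (suc k) f≗g = cong₂ _+_ (f≗g zero) (sumFin-cong k (f≗g ∘ suc))

sumFin-zero : ∀ k {f : Fin k → ℤ} → (∀ i → f i ≡ + 0) → sumFin k f ≡ + 0
sumFin-zero zero    f≡0 = refl
sumFin-zero (suc k) f≡0 = cong₂ _+_ (f≡0 zero) (sumFin-zero k (f≡0 ∘ suc))

sumFin-select : ∀ k (f : Fin k → ℤ) (j : Fin k) → (∀ i → i ≢ j → f i ≡ + 0) → sumFin k f ≡ f j
sumFin-select (suc k) f zero    f≡0 =
  trans (cong (_+_ (f zero)) (sumFin-zero k λ i → f≡0 (suc i) λ ())) (ℤP.+-identityʳ (f zero))
sumFin-select (suc k) f (suc j) f≡0 =
  trans (cong₂ _+_ (f≡0 zero λ ())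
                   (sumFin-select k (f ∘ suc) j λ i i≢j → f≡0 (suc i) (i≢j ∘ FinP.suc-injective)))
        (ℤP.+-identityˡ (f (suc j)))

sumFin-+ : ∀ k (f g : Fin k → ℤ) → sumFin k (λ i → f i + g i) ≡ sumFin k f + sumFin k g
sumFin-+ k f g rewrite sumFin≡sum k (λ i → f i + g i) | sumFin≡sum k f | sumFin≡sum k g = ∑-distrib-+ f g

neg-distrib-sumFin : ∀ k (f : Fin k → ℤ) → - sumFin k f ≡ sumFin k (λ i → - f i)
neg-distrib-sumFin zero    f = refl
neg-distrib-sumFin (suc k) f =
  trans (ℤP.neg-distrib-+ (f zero) _) (cong (_+_ (- f zero)) (neg-distrib-sumFin k (f ∘ suc)))

sumFin-- : ∀ k (f g : Fin k → ℤ) → sumFin k (λ i → f i - g i) ≡ sumFin k f - sumFin k g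
sumFin-- k f g = trans (sumFin-+ k f (λ i → - g i)) (cong (_+_ (sumFin k f)) (sym (neg-distrib-sumFin k g)))

*-distribˡ-sumFin : ∀ k a (f : Fin k → ℤ) → a * sumFin k f ≡ sumFin k (λ i → a * f i)
*-distribˡ-sumFin k a f rewrite sumFin≡sum k f | sumFin≡sum k (λ i → a * f i) = *-distribˡ-sum a f

*-distribʳ-sumFin : ∀ k a (f : Fin k → ℤ) → sumFin k f * a ≡ sumFin k (λ i → f i * a)
*-distribʳ-sumFin k a f rewrite sumFin≡sum k f | sumFin≡sum k (λ i → f i * a) = *-distribʳ-sum a f

sumFin-comm : ∀ k l (f : Fin k → Fin l → ℤ) →
  sumFin k (λ i → sumFin l (f i)) ≡ sumFin l (λ j → sumFin k (λ i → f i j))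
sumFin-comm k l f = begin
  sumFin k (λ i → sumFin l (f i))          ≡⟨ sumFin²≡sum² k l f ⟩
  sum (λ i → sum (f i))                    ≡⟨ ∑-comm f ⟩
  sum (λ j → sum (λ i → f i j))            ≡⟨ sumFin²≡sum² l k (λ j i → f i j) ⟨
  sumFin l (λ j → sumFin k (λ i → f i j))  ∎
  where
  sumFin²≡sum² : ∀ k l (g : Fin k → Fin l → ℤ) →
    sumFin k (λ i → sumFin l (g i)) ≡ sum (λ i → sum (g i))
  sumFin²≡sum² k l g = trans (sumFin-cong k λ i → sumFin≡sum l (g i)) (sumFin≡sum k _)

-- Alternation of the cofactor expansion

det-cong : ∀ k {A B : Matrix k} → (∀ r c → A r c ≡ B r c) → det k A ≡ det k B
det-cong zero    A≡B = refl
det-cong (suc k) A≡B = sumFin-cong (suc k) λ j →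
  cong (sgn (toℕ j) *_) (cong₂ _*_ (A≡B zero j) (det-cong k λ r c → A≡B (suc r) (punchIn j c)))

pairTerm : ∀ k → (Fin (suc (suc k)) → Fin (suc (suc k)) → ℤ) → ((Fin k → Fin (suc (suc k))) → ℤ) →
  Fin (suc (suc k)) → Fin (suc k) → ℤ
pairTerm k F G j l = sgn (toℕ j) * (sgn (toℕ l) * (F j (punchIn j l) * G (punchIn j ∘ punchIn l)))

-- Summing over j and l runs once over every ordered pair (j , punchIn j l) of distinct columns.
signedPairSum : ∀ k → (Fin (suc (suc k)) → Fin (suc (suc k)) → ℤ) → ((Fin k → Fin (suc (suc k))) → ℤ) → ℤ
signedPairSum k F G = sumFin (suc (suc k)) λ j → sumFin (suc k) (pairTerm k F G j)

signedPairSum-+ : ∀ k F F′ G →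
  signedPairSum k (λ x y → F x y + F′ x y) G ≡ signedPairSum k F G + signedPairSum k F′ G
signedPairSum-+ k F F′ G = begin
  signedPairSum k (λ x y → F x y + F′ x y) G
    ≡⟨ sumFin-cong (suc (suc k)) (λ j → trans (sumFin-cong (suc k) (distrib j))
                                              (sumFin-+ (suc k) (pairTerm k F G j) (pairTerm k F′ G j))) ⟩
  sumFin (suc (suc k)) (λ j → rowSum F j + rowSum F′ j)
    ≡⟨ sumFin-+ (suc (suc k)) (rowSum F) (rowSum F′) ⟩
  signedPairSum k F G + signedPairSum k F′ G ∎
  where
  rowSum : (Fin (suc (suc k)) → Fin (suc (suc k)) → ℤ) → Fin (suc (suc k)) → ℤ
  rowSum F j = sumFin (suc k) (pairTerm k F G j)
  expand : ∀ s t a b g → s * (t * ((a + b) * g)) ≡ s * (t * (a * g)) + s * (t * (b * g))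
  expand = solve-∀
  distrib : ∀ j l → pairTerm k (λ x y → F x y + F′ x y) G j l ≡ pairTerm k F G j l + pairTerm k F′ G j l
  distrib j l =
    expand (sgn (toℕ j)) (sgn (toℕ l)) (F j (punchIn j l)) (F′ j (punchIn j l)) (G (punchIn j ∘ punchIn l))

-- The pair (j , j′) and its transpose (j′ , j) carry opposite signs and the same lower block;
-- peeling off the pairs containing column zero reduces to the same statement one size down.
signedPairSum≡0 : ∀ k F G → (∀ x y → F x y ≡ F y x) → (∀ {σ τ} → σ ≗ τ → G σ ≡ G τ) →
  signedPairSum k F G ≡ + 0

innerPairSum≡0 : ∀ k F G → (∀ x y → F x y ≡ F y x) → (∀ {σ τ} → σ ≗ τ → G σ ≡ G τ) →
  sumFin (suc k) (λ j → sumFin k (pairTerm k F G (suc j) ∘ suc)) ≡ + 0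

signedPairSum≡0 k F G F-sym G-ext = begin
  sumFin (suc k) (T zero) + sumFin (suc k) (λ j → T (suc j) zero + sumFin k (T (suc j) ∘ suc))
    ≡⟨ cong (_+_ (sumFin (suc k) (T zero))) (sumFin-+ (suc k) (λ j → T (suc j) zero) inner) ⟩
  sumFin (suc k) (T zero) + (sumFin (suc k) (λ j → T (suc j) zero) + sumFin (suc k) inner)
    ≡⟨ ℤP.+-assoc (sumFin (suc k) (T zero)) (sumFin (suc k) (λ j → T (suc j) zero)) (sumFin (suc k) inner) ⟨
  (sumFin (suc k) (T zero) + sumFin (suc k) (λ j → T (suc j) zero)) + sumFin (suc k) inner
    ≡⟨ cong₂ _+_ (sym (sumFin-+ (suc k) (T zero) (λ j → T (suc j) zero))) (innerPairSum≡0 k F G F-sym G-ext) ⟩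
  sumFin (suc k) (λ l → T zero l + T (suc l) zero) + + 0
    ≡⟨ cong₂ _+_ (sumFin-zero (suc k) cancel) refl ⟩
  + 0 ∎
  where
  T : Fin (suc (suc k)) → Fin (suc k) → ℤ
  T = pairTerm k F G
  inner : Fin (suc k) → ℤ
  inner j = sumFin k (T (suc j) ∘ suc)
  opposite : ∀ s x → + 1 * (s * x) + - s * (+ 1 * x) ≡ + 0
  opposite = solve-∀
  cancel : ∀ l → T zero l + T (suc l) zero ≡ + 0
  cancel l = begin
    T zero l + T (suc l) zero
      ≡⟨ cong (λ f → T zero l + - sgn (toℕ l) * (+ 1 * (f * g))) (F-sym (suc l) zero) ⟩
    + 1 * (sgn (toℕ l) * (F zero (suc l) * g)) + - sgn (toℕ l) * (+ 1 * (F zero (suc l) * g))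
      ≡⟨ opposite (sgn (toℕ l)) (F zero (suc l) * g) ⟩
    + 0 ∎
    where
    g : ℤ
    g = G (suc ∘ punchIn l)

innerPairSum≡0 zero    F G F-sym G-ext = refl
innerPairSum≡0 (suc k) F G F-sym G-ext = begin
  sumFin (suc (suc k)) (λ j → sumFin (suc k) (pairTerm (suc k) F G (suc j) ∘ suc))
    ≡⟨ sumFin-cong (suc (suc k)) (λ j → sumFin-cong (suc k) (shift j)) ⟩
  signedPairSum k F′ G′
    ≡⟨ signedPairSum≡0 k F′ G′ (λ x y → F-sym (suc x) (suc y))
         (λ σ≗τ → G-ext λ { zero → refl ; (suc c) → cong suc (σ≗τ c) }) ⟩
  + 0 ∎
  where
  F′ : Fin (suc (suc k)) → Fin (suc (suc k)) → ℤ
  F′ x y = F (suc x) (suc y)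
  G′ : (Fin k → Fin (suc (suc k))) → ℤ
  G′ τ = G (lift 1 τ)
  neg*neg : ∀ a b x → - a * (- b * x) ≡ a * (b * x)
  neg*neg = solve-∀
  shift : ∀ j l → pairTerm (suc k) F G (suc j) (suc l) ≡ pairTerm k F′ G′ j l
  shift j l = begin
    - sgn (toℕ j) * (- sgn (toℕ l) * (f * G (punchIn (suc j) ∘ punchIn (suc l))))
      ≡⟨ cong (λ g → - sgn (toℕ j) * (- sgn (toℕ l) * (f * g))) (G-ext lift≗) ⟩
    - sgn (toℕ j) * (- sgn (toℕ l) * (f * G′ (punchIn j ∘ punchIn l)))
      ≡⟨ neg*neg (sgn (toℕ j)) (sgn (toℕ l)) (f * G′ (punchIn j ∘ punchIn l)) ⟩
    pairTerm k F′ G′ j l ∎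
    where
    f : ℤ
    f = F (suc j) (suc (punchIn j l))
    lift≗ : punchIn (suc j) ∘ punchIn (suc l) ≗ lift 1 (punchIn j ∘ punchIn l)
    lift≗ zero    = refl
    lift≗ (suc c) = refl

detBelow : ∀ k → Matrix (suc (suc k)) → (Fin k → Fin (suc (suc k))) → ℤ
detBelow k A σ = det k (λ r c → A (suc (suc r)) (σ c))

det-expand₂ : ∀ k (A : Matrix (suc (suc k))) →
  det (suc (suc k)) A ≡ signedPairSum k (λ j j′ → A zero j * A (suc zero) j′) (detBelow k A)
det-expand₂ k A = sumFin-cong (suc (suc k)) λ j → begin
  sgn (toℕ j) * (A zero j * sumFin (suc k) (cofactor j))
    ≡⟨ cong (sgn (toℕ j) *_) (*-distribˡ-sumFin (suc k) (A zero j) (cofactor j)) ⟩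
  sgn (toℕ j) * sumFin (suc k) (λ l → A zero j * cofactor j l)
    ≡⟨ *-distribˡ-sumFin (suc k) (sgn (toℕ j)) (λ l → A zero j * cofactor j l) ⟩
  sumFin (suc k) (λ l → sgn (toℕ j) * (A zero j * cofactor j l))
    ≡⟨ sumFin-cong (suc k) (λ l → regroup (sgn (toℕ j)) (A zero j) (sgn (toℕ l)) (A (suc zero) (punchIn j l))
                                           (detBelow k A (punchIn j ∘ punchIn l))) ⟩
  sumFin (suc k) (pairTerm k (λ j j′ → A zero j * A (suc zero) j′) (detBelow k A) j) ∎
  where
  cofactor : Fin (suc (suc k)) → Fin (suc k) → ℤ
  cofactor j l = sgn (toℕ l) * (A (suc zero) (punchIn j l) * detBelow k A (punchIn j ∘ punchIn l))
  regroup : ∀ s a t b d → s * (a * (t * (b * d))) ≡ s * (t * ((a * b) * d))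
  regroup = solve-∀

swap₀₁ : ∀ {k} → Matrix (suc (suc k)) → Matrix (suc (suc k))
swap₀₁ A zero          = A (suc zero)
swap₀₁ A (suc zero)    = A zero
swap₀₁ A (suc (suc r)) = A (suc (suc r))

det-swap₀₁ : ∀ k (A : Matrix (suc (suc k))) → det (suc (suc k)) (swap₀₁ A) ≡ - det (suc (suc k)) A
det-swap₀₁ k A = inverseʳ-unique (det (suc (suc k)) A) (det (suc (suc k)) (swap₀₁ A)) (begin
  det (suc (suc k)) A + det (suc (suc k)) (swap₀₁ A)
    ≡⟨ cong₂ _+_ (det-expand₂ k A) (det-expand₂ k (swap₀₁ A)) ⟩
  signedPairSum k F (detBelow k A) + signedPairSum k F′ (detBelow k A)
    ≡⟨ signedPairSum-+ k F F′ (detBelow k A) ⟨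
  signedPairSum k (λ x y → F x y + F′ x y) (detBelow k A)
    ≡⟨ signedPairSum≡0 k (λ x y → F x y + F′ x y) (detBelow k A)
         (λ x y → transpose (A zero x) (A (suc zero) y) (A (suc zero) x) (A zero y))
         (λ σ≗τ → det-cong k λ r c → cong (A (suc (suc r))) (σ≗τ c)) ⟩
  + 0 ∎)
  where
  F F′ : Fin (suc (suc k)) → Fin (suc (suc k)) → ℤ
  F  x y = A zero x * A (suc zero) y
  F′ x y = A (suc zero) x * A zero y
  transpose : ∀ a b c d → a * b + c * d ≡ d * c + b * a
  transpose = solve-∀

x≡-x⇒x≡0 : ∀ {x : ℤ} → x ≡ - x → x ≡ + 0
x≡-x⇒x≡0 {x = + zero}    _  = refl
x≡-x⇒x≡0 {x = + suc _}   ()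
x≡-x⇒x≡0 {x = -[1+ _ ]} ()

det-rows-equal : ∀ k (A : Matrix (suc k)) (p : Fin k) → (∀ c → A zero c ≡ A (suc p) c) →
  det (suc k) A ≡ + 0
det-rows-equal (suc k) A zero    A₀≡A₁ =
  x≡-x⇒x≡0 (trans (det-cong (suc (suc k)) swap≡id) (det-swap₀₁ k A))
  where
  swap≡id : ∀ r c → A r c ≡ swap₀₁ A r c
  swap≡id zero          c = A₀≡A₁ c
  swap≡id (suc zero)    c = sym (A₀≡A₁ c)
  swap≡id (suc (suc r)) c = refl
det-rows-equal (suc k) A (suc p) A₀≡Aₚ = begin
  det (suc (suc k)) A                  ≡⟨ ℤP.neg-involutive _ ⟨
  - - det (suc (suc k)) A              ≡⟨ cong -_ (det-swap₀₁ k A) ⟨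
  - det (suc (suc k)) (swap₀₁ A)       ≡⟨ cong -_ (sumFin-zero (suc (suc k)) minor≡0) ⟩
  + 0                                  ∎
  where
  minor≡0 : ∀ j → sgn (toℕ j) * (A (suc zero) j * det (suc k) (minor (swap₀₁ A) zero j)) ≡ + 0
  minor≡0 j = begin
    sgn (toℕ j) * (A (suc zero) j * det (suc k) (minor (swap₀₁ A) zero j))
      ≡⟨ cong (λ d → sgn (toℕ j) * (A (suc zero) j * d))
              (det-rows-equal k (minor (swap₀₁ A) zero j) p λ c → A₀≡Aₚ (punchIn j c)) ⟩
    sgn (toℕ j) * (A (suc zero) j * + 0)
      ≡⟨ cong (sgn (toℕ j) *_) (ℤP.*-zeroʳ (A (suc zero) j)) ⟩
    sgn (toℕ j) * + 0
      ≡⟨ ℤP.*-zeroʳ (sgn (toℕ j)) ⟩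
    + 0 ∎

-- Row operations on the first row

setRow₀ : ∀ {k} → Matrix (suc k) → (Fin (suc k) → ℤ) → Matrix (suc k)
setRow₀ A v zero    = v
setRow₀ A v (suc r) = A (suc r)

det-setRow₀-+ : ∀ k (A : Matrix (suc k)) (u w : Fin (suc k) → ℤ) →
  det (suc k) (setRow₀ A (λ c → u c + w c)) ≡ det (suc k) (setRow₀ A u) + det (suc k) (setRow₀ A w)
det-setRow₀-+ k A u w =
  trans (sumFin-cong (suc k) λ j → distrib (sgn (toℕ j)) (u j) (w j) (det k (minor A zero j)))
        (sumFin-+ (suc k) (λ j → sgn (toℕ j) * (u j * det k (minor A zero j)))
                          (λ j → sgn (toℕ j) * (w j * det k (minor A zero j))))
  where
  distrib : ∀ s a b d → s * ((a + b) * d) ≡ s * (a * d) + s * (b * d)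
  distrib = solve-∀

det-setRow₀-∑ : ∀ k m (A : Matrix (suc k)) (x : Fin m → ℤ) (B : Fin m → Fin (suc k) → ℤ) →
  det (suc k) (setRow₀ A (λ c → sumFin m (λ p → x p * B p c)))
    ≡ sumFin m (λ p → x p * det (suc k) (setRow₀ A (B p)))
det-setRow₀-∑ k m A x B = begin
  sumFin (suc k) (λ j → sgn (toℕ j) * (sumFin m (λ p → x p * B p j) * D j))
    ≡⟨ sumFin-cong (suc k) pull-in ⟩
  sumFin (suc k) (λ j → sumFin m (λ p → x p * (sgn (toℕ j) * (B p j * D j))))
    ≡⟨ sumFin-comm (suc k) m (λ j p → x p * (sgn (toℕ j) * (B p j * D j))) ⟩
  sumFin m (λ p → sumFin (suc k) (λ j → x p * (sgn (toℕ j) * (B p j * D j))))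
    ≡⟨ sumFin-cong m (λ p → *-distribˡ-sumFin (suc k) (x p) (λ j → sgn (toℕ j) * (B p j * D j))) ⟨
  sumFin m (λ p → x p * det (suc k) (setRow₀ A (B p))) ∎
  where
  D : Fin (suc k) → ℤ
  D j = det k (minor A zero j)
  regroup : ∀ s a b d → s * ((a * b) * d) ≡ a * (s * (b * d))
  regroup = solve-∀
  pull-in : ∀ j → sgn (toℕ j) * (sumFin m (λ p → x p * B p j) * D j)
                ≡ sumFin m (λ p → x p * (sgn (toℕ j) * (B p j * D j)))
  pull-in j = begin
    sgn (toℕ j) * (sumFin m (λ p → x p * B p j) * D j)
      ≡⟨ cong (sgn (toℕ j) *_) (*-distribʳ-sumFin m (D j) (λ p → x p * B p j)) ⟩
    sgn (toℕ j) * sumFin m (λ p → (x p * B p j) * D j)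
      ≡⟨ *-distribˡ-sumFin m (sgn (toℕ j)) (λ p → (x p * B p j) * D j) ⟩
    sumFin m (λ p → sgn (toℕ j) * ((x p * B p j) * D j))
      ≡⟨ sumFin-cong m (λ p → regroup (sgn (toℕ j)) (x p) (B p j) (D j)) ⟩
    sumFin m (λ p → x p * (sgn (toℕ j) * (B p j * D j))) ∎

combinedRow : ∀ {k} → Matrix (suc k) → (Fin k → ℤ) → Fin (suc k) → ℤ
combinedRow {k} A x c = A zero c + sumFin k (λ p → x p * A (suc p) c)

det-addRows₀ : ∀ k (A : Matrix (suc k)) (x : Fin k → ℤ) →
  det (suc k) (setRow₀ A (combinedRow A x)) ≡ det (suc k) A
det-addRows₀ k A x = begin
  det (suc k) (setRow₀ A (combinedRow A x))
    ≡⟨ det-setRow₀-+ k A (A zero) (λ c → sumFin k (λ p → x p * A (suc p) c)) ⟩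
  det (suc k) A + det (suc k) (setRow₀ A (λ c → sumFin k (λ p → x p * A (suc p) c)))
    ≡⟨ cong (_+_ (det (suc k) A)) (det-setRow₀-∑ k k A x (A ∘ suc)) ⟩
  det (suc k) A + sumFin k (λ p → x p * det (suc k) (setRow₀ A (A (suc p))))
    ≡⟨ cong (_+_ (det (suc k) A)) (sumFin-zero k λ p →
         trans (cong (x p *_) (det-rows-equal k (setRow₀ A (A (suc p))) p λ _ → refl)) (ℤP.*-zeroʳ (x p))) ⟩
  det (suc k) A + + 0
    ≡⟨ ℤP.+-identityʳ (det (suc k) A) ⟩
  det (suc k) A ∎

det-row₀-single : ∀ k (A : Matrix (suc k)) (j : Fin (suc k)) → (∀ c → c ≢ j → A zero c ≡ + 0) →
  det (suc k) A ≡ sgn (toℕ j) * (A zero j * det k (minor A zero j))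
det-row₀-single k A j A₀≡0 = sumFin-select (suc k) _ j λ c c≢j →
  trans (cong (λ a → sgn (toℕ c) * (a * det k (minor A zero c))) (A₀≡0 c c≢j)) (ℤP.*-zeroʳ (sgn (toℕ c)))

det-reduceRow₀ : ∀ k (A : Matrix (suc k)) (x : Fin k → ℤ) (j : Fin (suc k)) →
  (∀ c → c ≢ j → combinedRow A x c ≡ + 0) →
  det (suc k) A ≡ sgn (toℕ j) * (combinedRow A x j * det k (minor A zero j))
det-reduceRow₀ k A x j row≡0 =
  trans (sym (det-addRows₀ k A x)) (det-row₀-single k (setRow₀ A (combinedRow A x)) j row≡0)

-- The matrices M and E

toℕ-punchIn-< : ∀ {n} (j : Fin (suc n)) (c : Fin n) → toℕ c < toℕ j → toℕ (punchIn j c) ≡ toℕ c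
toℕ-punchIn-< (suc j) zero    _         = refl
toℕ-punchIn-< (suc j) (suc c) (s≤s c<j) = cong suc (toℕ-punchIn-< j c c<j)

toℕ-punchIn-≥ : ∀ {n} (j : Fin (suc n)) (c : Fin n) → toℕ j ≤ toℕ c → toℕ (punchIn j c) ≡ suc (toℕ c)
toℕ-punchIn-≥ zero    c       _         = refl
toℕ-punchIn-≥ (suc j) (suc c) (s≤s j≤c) = cong suc (toℕ-punchIn-≥ j c j≤c)

δ : ℕ → ℕ → ℤ
δ a b = if a ℕ.≡ᵇ b then + 1 else + 0

δ-refl : ∀ a → δ a a ≡ + 1
δ-refl zero    = refl
δ-refl (suc a) = δ-refl a

δ-≢ : ∀ {a b} → a ≢ b → δ a b ≡ + 0
δ-≢ {zero}  {zero}  a≢b = contradiction refl a≢b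
δ-≢ {zero}  {suc b} _   = refl
δ-≢ {suc a} {zero}  _   = refl
δ-≢ {suc a} {suc b} a≢b = δ-≢ (a≢b ∘ cong suc)

-- entry d i j reduces to hankel d (i + j).
hankel : ℕ → ℕ → ℤ
hankel d x = if x ℕ.≡ᵇ d then + 0 else if suc x ℕ.≡ᵇ d then + 2 else + 1

hankel-δ : ∀ d x → hankel d x ≡ + 1 - δ x d + δ (suc x) d
hankel-δ zero          zero    = refl
hankel-δ zero          (suc x) = refl
hankel-δ (suc zero)    zero    = refl
hankel-δ (suc (suc d)) zero    = refl
hankel-δ (suc d)       (suc x) = hankel-δ d x

hankel-beyond : ∀ {d x} → d < x → hankel d x ≡ + 1
hankel-beyond {d} {x} d<x = begin
  hankel d x                   ≡⟨ hankel-δ d x ⟩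
  + 1 - δ x d + δ (suc x) d    ≡⟨ cong₂ (λ a b → + 1 - a + b) (δ-≢ (ℕP.>⇒≢ d<x))
                                                                (δ-≢ (ℕP.>⇒≢ (ℕP.m<n⇒m<1+n d<x))) ⟩
  + 1                          ∎

-- M n is H (n ∸ 1) n definitionally.
H : (s d : ℕ) → Matrix s
H s d r c = entry d (suc (toℕ r)) (suc (toℕ c))

E : (s : ℕ) → Matrix s
E s = H s s

δSum : ℕ → (ℕ → ℤ) → ℕ → ℕ → ℤ
δSum s y a d = sumFin s (λ ρ → y (toℕ ρ) * δ (a ℕ.+ toℕ ρ) d)

δSum-suc : ∀ s y a d → δSum (suc s) y a d ≡ y 0 * δ a d + δSum s (y ∘ suc) (suc a) d
δSum-suc s y a d = cong₂ _+_
  (cong (λ x → y 0 * δ x d) (ℕP.+-identityʳ a))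
  (sumFin-cong s λ ρ → cong (λ x → y (suc (toℕ ρ)) * δ x d) (ℕP.+-suc a (toℕ ρ)))

δSum-miss : ∀ s y {a d} → d < a → δSum s y a d ≡ + 0
δSum-miss zero    y     d<a = refl
δSum-miss (suc s) y {a} {d} d<a = begin
  δSum (suc s) y a d
    ≡⟨ δSum-suc s y a d ⟩
  y 0 * δ a d + δSum s (y ∘ suc) (suc a) d
    ≡⟨ cong₂ (λ u v → y 0 * u + v) (δ-≢ (ℕP.>⇒≢ d<a))
                                    (δSum-miss s (y ∘ suc) (ℕP.m<n⇒m<1+n d<a)) ⟩
  y 0 * + 0 + + 0
    ≡⟨ trans (ℤP.+-identityʳ (y 0 * + 0)) (ℤP.*-zeroʳ (y 0)) ⟩
  + 0 ∎

δSum-hit : ∀ s y a {t d} → t < s → d ≡ a ℕ.+ t → δSum s y a d ≡ y t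
δSum-hit (suc s) y a {zero} {d} _ d≡a+0 = begin
  δSum (suc s) y a d
    ≡⟨ δSum-suc s y a d ⟩
  y 0 * δ a d + δSum s (y ∘ suc) (suc a) d
    ≡⟨ cong₂ (λ u v → y 0 * u + v) (trans (cong (δ a) d≡a) (δ-refl a))
                                    (δSum-miss s (y ∘ suc) (s≤s (ℕP.≤-reflexive d≡a))) ⟩
  y 0 * + 1 + + 0
    ≡⟨ trans (ℤP.+-identityʳ (y 0 * + 1)) (ℤP.*-identityʳ (y 0)) ⟩
  y 0 ∎
  where d≡a = trans d≡a+0 (ℕP.+-identityʳ a)
δSum-hit (suc s) y a {suc t} {d} (s≤s t<s) d≡a+1+t = begin
  δSum (suc s) y a d
    ≡⟨ δSum-suc s y a d ⟩
  y 0 * δ a d + δSum s (y ∘ suc) (suc a) d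
    ≡⟨ cong₂ (λ u v → y 0 * u + v) (δ-≢ λ a≡d → ℕP.m+1+n≢m a (trans (sym d≡a+1+t) (sym a≡d)))
                                    (δSum-hit s (y ∘ suc) (suc a) t<s (trans d≡a+1+t (ℕP.+-suc a t))) ⟩
  y 0 * + 0 + y (suc t)
    ≡⟨ trans (cong (_+ y (suc t)) (ℤP.*-zeroʳ (y 0))) (ℤP.+-identityˡ (y (suc t))) ⟩
  y (suc t) ∎

weightSum : ℕ → (ℕ → ℤ) → ℤ
weightSum s y = sumFin s (y ∘ toℕ)

weightSum-last : ∀ s y → weightSum (suc s) y ≡ weightSum s y + y s
weightSum-last zero    y = trans (ℤP.+-identityʳ (y 0)) (sym (ℤP.+-identityˡ (y 0)))
weightSum-last (suc s) y =
  trans (cong (_+_ (y 0)) (weightSum-last s (y ∘ suc)))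
        (sym (ℤP.+-assoc (y 0) (weightSum s (y ∘ suc)) (y (suc s))))

weightSum-const : ∀ s → weightSum s (λ _ → + 1) ≡ + s
weightSum-const zero    = refl
weightSum-const (suc s) = cong (_+_ (+ 1)) (weightSum-const s)

weightSum-triangle : ∀ s → weightSum s (λ ρ → + suc ρ) ≡ + (suc s C 2)
weightSum-triangle zero    = refl
weightSum-triangle (suc s) = begin
  weightSum (suc s) (λ ρ → + suc ρ)       ≡⟨ weightSum-last s (λ ρ → + suc ρ) ⟩
  weightSum s (λ ρ → + suc ρ) + + suc s   ≡⟨ cong (_+ + suc s) (weightSum-triangle s) ⟩
  + (suc s C 2 ℕ.+ suc s)            ≡⟨ cong +_ pascal ⟩
  + (suc (suc s) C 2)                ∎
  where
  pascal : suc s C 2 ℕ.+ suc s ≡ suc (suc s) C 2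
  pascal = begin
    suc s C 2 ℕ.+ suc s      ≡⟨ ℕP.+-comm (suc s C 2) (suc s) ⟩
    suc s ℕ.+ suc s C 2      ≡⟨ cong (ℕ._+ suc s C 2) (ℕC.nC1≡n (suc s)) ⟨
    suc s C 1 ℕ.+ suc s C 2  ≡⟨ ℕC.nCk+nC[k+1]≡[n+1]C[k+1] (suc s) 1 ⟩
    suc (suc s) C 2          ∎

weightSum-spike : ∀ s f {t} X → t < s → weightSum s (λ ρ → f ρ - δ ρ t * X) ≡ weightSum s f - X
weightSum-spike s f {t} X t<s = begin
  weightSum s (λ ρ → f ρ - δ ρ t * X)
    ≡⟨ sumFin-- s (f ∘ toℕ) (λ ρ → δ (toℕ ρ) t * X) ⟩
  weightSum s f - sumFin s (λ ρ → δ (toℕ ρ) t * X)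
    ≡⟨ cong (λ z → weightSum s f - z) spike ⟩
  weightSum s f - X ∎
  where
  spike : sumFin s (λ ρ → δ (toℕ ρ) t * X) ≡ X
  spike = trans (sumFin-cong s λ ρ → ℤP.*-comm (δ (toℕ ρ) t) X) (δSum-hit s (λ _ → X) 0 t<s refl)

weightedRow : ℕ → ℕ → (ℕ → ℤ) → ℕ → ℤ
weightedRow s d y c = sumFin s (λ ρ → y (toℕ ρ) * hankel d (suc (toℕ ρ) ℕ.+ suc c))

-- Row ρ of H s d is the all-ones row, minus the unit row at column d − 2 − ρ, plus the one at
-- d − 3 − ρ; so in a weighted sum of the rows the weights telescope.
weightedRow-δ : ∀ s d y c →
  weightedRow s d y c ≡ weightSum s y - δSum s y (suc (suc c)) d + δSum s y (suc (suc (suc c))) d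
weightedRow-δ s d y c = begin
  weightedRow s d y c
    ≡⟨ sumFin-cong s split ⟩
  sumFin s (λ ρ → (y (toℕ ρ) - y (toℕ ρ) * δ₂ ρ) + y (toℕ ρ) * δ₃ ρ)
    ≡⟨ sumFin-+ s (λ ρ → y (toℕ ρ) - y (toℕ ρ) * δ₂ ρ) (λ ρ → y (toℕ ρ) * δ₃ ρ) ⟩
  sumFin s (λ ρ → y (toℕ ρ) - y (toℕ ρ) * δ₂ ρ) + δSum s y (suc (suc (suc c))) d
    ≡⟨ cong (_+ δSum s y (suc (suc (suc c))) d) (sumFin-- s (y ∘ toℕ) (λ ρ → y (toℕ ρ) * δ₂ ρ)) ⟩
  weightSum s y - δSum s y (suc (suc c)) d + δSum s y (suc (suc (suc c))) d ∎
  where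
  δ₂ δ₃ : Fin s → ℤ
  δ₂ ρ = δ (suc (suc c) ℕ.+ toℕ ρ) d
  δ₃ ρ = δ (suc (suc (suc c)) ℕ.+ toℕ ρ) d
  distrib : ∀ a p q → a * (+ 1 - p + q) ≡ (a - a * p) + a * q
  distrib = solve-∀
  index : ∀ ρ → suc ρ ℕ.+ suc c ≡ suc (suc c) ℕ.+ ρ
  index ρ = cong suc (trans (ℕP.+-suc ρ c) (cong suc (ℕP.+-comm ρ c)))
  split : ∀ ρ → y (toℕ ρ) * hankel d (suc (toℕ ρ) ℕ.+ suc c)
              ≡ (y (toℕ ρ) - y (toℕ ρ) * δ₂ ρ) + y (toℕ ρ) * δ₃ ρ
  split ρ = begin
    y (toℕ ρ) * hankel d (suc (toℕ ρ) ℕ.+ suc c)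
      ≡⟨ cong (λ x → y (toℕ ρ) * hankel d x) (index (toℕ ρ)) ⟩
    y (toℕ ρ) * hankel d (suc (suc c) ℕ.+ toℕ ρ)
      ≡⟨ cong (y (toℕ ρ) *_) (hankel-δ d (suc (suc c) ℕ.+ toℕ ρ)) ⟩
    y (toℕ ρ) * (+ 1 - δ₂ ρ + δ₃ ρ)
      ≡⟨ distrib (y (toℕ ρ)) (δ₂ ρ) (δ₃ ρ) ⟩
    (y (toℕ ρ) - y (toℕ ρ) * δ₂ ρ) + y (toℕ ρ) * δ₃ ρ ∎

weightedRow-interior : ∀ s d y c o → suc o < s → d ≡ suc (suc (suc c)) ℕ.+ o →
  weightedRow s d y c ≡ weightSum s y - y (suc o) + y o
weightedRow-interior s d y c o 1+o<s d≡ = trans (weightedRow-δ s d y c) (cong₂ (λ a b → weightSum s y - a + b)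
  (δSum-hit s y (suc (suc c)) 1+o<s (trans d≡ (sym (ℕP.+-suc (suc (suc c)) o))))
  (δSum-hit s y (suc (suc (suc c))) (ℕP.<-trans (ℕP.n<1+n o) 1+o<s) d≡))

weightedRow-edge : ∀ s d y c → 0 < s → d ≡ suc (suc c) → weightedRow s d y c ≡ weightSum s y - y 0
weightedRow-edge s d y c 0<s d≡ = begin
  weightedRow s d y c
    ≡⟨ weightedRow-δ s d y c ⟩
  weightSum s y - δSum s y (suc (suc c)) d + δSum s y (suc (suc (suc c))) d
    ≡⟨ cong₂ (λ a b → weightSum s y - a + b)
         (δSum-hit s y (suc (suc c)) 0<s (trans d≡ (sym (ℕP.+-identityʳ (suc (suc c))))))
         (δSum-miss s y (s≤s (ℕP.≤-reflexive d≡))) ⟩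
  weightSum s y - y 0 + + 0
    ≡⟨ ℤP.+-identityʳ _ ⟩
  weightSum s y - y 0 ∎

weightedRow-beyond : ∀ s d y c → d < suc (suc c) → weightedRow s d y c ≡ weightSum s y
weightedRow-beyond s d y c d<2+c = begin
  weightedRow s d y c
    ≡⟨ weightedRow-δ s d y c ⟩
  weightSum s y - δSum s y (suc (suc c)) d + δSum s y (suc (suc (suc c))) d
    ≡⟨ cong₂ (λ a b → weightSum s y - a + b) (δSum-miss s y d<2+c)
                                              (δSum-miss s y (ℕP.m<n⇒m<1+n d<2+c)) ⟩
  weightSum s y + + 0 + + 0
    ≡⟨ trans (ℤP.+-identityʳ _) (ℤP.+-identityʳ _) ⟩
  weightSum s y ∎

det-H-reduceRow₀ : ∀ s d (y : ℕ → ℤ) → y 0 ≡ + 1 → (j : Fin (suc s)) →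
  (∀ c → c ≢ j → weightedRow (suc s) d y (toℕ c) ≡ + 0) →
  det (suc s) (H (suc s) d)
    ≡ sgn (toℕ j) * (weightedRow (suc s) d y (toℕ j) * det s (minor (H (suc s) d) zero j))
det-H-reduceRow₀ s d y y₀≡1 j row≡0 = begin
  det (suc s) (H (suc s) d)
    ≡⟨ det-reduceRow₀ s (H (suc s) d) (y ∘ suc ∘ toℕ) j
         (λ c c≢j → trans (combined≡weighted c) (row≡0 c c≢j)) ⟩
  sgn (toℕ j) * (combinedRow (H (suc s) d) (y ∘ suc ∘ toℕ) j * det s (minor (H (suc s) d) zero j))
    ≡⟨ cong (λ v → sgn (toℕ j) * (v * det s (minor (H (suc s) d) zero j))) (combined≡weighted j) ⟩
  sgn (toℕ j) * (weightedRow (suc s) d y (toℕ j) * det s (minor (H (suc s) d) zero j)) ∎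
  where
  combined≡weighted : ∀ c →
    combinedRow (H (suc s) d) (y ∘ suc ∘ toℕ) c ≡ weightedRow (suc s) d y (toℕ c)
  combined≡weighted c = cong (_+ sumFin s (λ p → y (suc (toℕ p)) * H (suc s) d (suc p) c))
    (trans (sym (ℤP.*-identityˡ (H (suc s) d zero c))) (cong (_* H (suc s) d zero c) (sym y₀≡1)))

-- Constant weights make the interior differences vanish; the last one makes them sum to zero.
eWeights : ℕ → ℕ → ℤ
eWeights t ρ = + 1 - δ ρ (suc t) * + suc (suc t)

eRow : ℕ → ℕ → ℤ
eRow t = weightedRow (suc (suc t)) (suc (suc t)) (eWeights t)

eWeights-≢ : ∀ t {ρ} → ρ ≢ suc t → eWeights t ρ ≡ + 1
eWeights-≢ t ρ≢ = cong (λ e → + 1 - e * + suc (suc t)) (δ-≢ ρ≢)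

weightSum-eWeights : ∀ t → weightSum (suc (suc t)) (eWeights t) ≡ + 0
weightSum-eWeights t = begin
  weightSum (suc (suc t)) (eWeights t)
    ≡⟨ weightSum-spike (suc (suc t)) (λ _ → + 1) (+ suc (suc t)) ℕP.≤-refl ⟩
  weightSum (suc (suc t)) (λ _ → + 1) - + suc (suc t)
    ≡⟨ cong (_- + suc (suc t)) (weightSum-const (suc (suc t))) ⟩
  + suc (suc t) - + suc (suc t)
    ≡⟨ ℤP.+-inverseʳ (+ suc (suc t)) ⟩
  + 0 ∎

eRow-≢ : ∀ t (c : Fin (suc (suc t))) → toℕ c ≢ t → eRow t (toℕ c) ≡ + 0
eRow-≢ t c c≢t with ℕP.<-cmp (toℕ c) t
... | tri≈ _ c≡t _ = contradiction c≡t c≢t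
... | tri> _ _ t<c =
  trans (weightedRow-beyond (suc (suc t)) (suc (suc t)) (eWeights t) (toℕ c) (s≤s (s≤s t<c)))
        (weightSum-eWeights t)
... | tri< c<t _ _ with ℕP.m≤n⇒∃[o]m+o≡n c<t
...   | o , 1+c+o≡t = begin
  eRow t (toℕ c)
    ≡⟨ weightedRow-interior (suc (suc t)) (suc (suc t)) (eWeights t) (toℕ c) o
         (s≤s (ℕP.m<n⇒m<1+n o<t)) (cong (2 ℕ.+_) (sym 1+c+o≡t)) ⟩
  weightSum (suc (suc t)) (eWeights t) - eWeights t (suc o) + eWeights t o
    ≡⟨ cong₂ (λ a b → weightSum (suc (suc t)) (eWeights t) - a + b)
         (eWeights-≢ t (ℕP.<⇒≢ (s≤s o<t))) (eWeights-≢ t (ℕP.<⇒≢ (ℕP.m<n⇒m<1+n o<t))) ⟩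
  weightSum (suc (suc t)) (eWeights t) - + 1 + + 1
    ≡⟨ cong (λ σ → σ - + 1 + + 1) (weightSum-eWeights t) ⟩
  + 0 ∎
  where
  o<t : o < t
  o<t = subst (o <_) 1+c+o≡t (s≤s (ℕP.m≤n+m o (toℕ c)))

eRow-t : ∀ t → eRow t t ≡ - + 1
eRow-t t = trans (weightedRow-edge (suc (suc t)) (suc (suc t)) (eWeights t) t (s≤s z≤n) refl)
                 (cong (_- + 1) (weightSum-eWeights t))

column : ∀ t → Fin (suc (suc t))
column t = fromℕ< (ℕP.m<n⇒m<1+n (ℕP.n<1+n t))

toℕ-column : ∀ t → toℕ (column t) ≡ t
toℕ-column t = FinP.toℕ-fromℕ< (ℕP.m<n⇒m<1+n (ℕP.n<1+n t))

minor-E : ∀ t r c → minor (E (suc (suc t))) zero (column t) r c ≡ E (suc t) r c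
minor-E t r c with ℕP.m≤n⇒m<n∨m≡n (FinP.toℕ≤pred[n] c)
... | inj₁ c<t = cong (λ x → hankel t (toℕ r ℕ.+ suc x))
                      (toℕ-punchIn-< (column t) c (subst (toℕ c <_) (sym (toℕ-column t)) c<t))
... | inj₂ c≡t = trans (hankel-beyond (past t≤c′)) (sym (hankel-beyond (past (ℕP.≤-reflexive (sym c≡t)))))
  where
  past : ∀ {x} → t ≤ x → t < toℕ r ℕ.+ suc x
  past {x} t≤x = ℕP.≤-trans (s≤s t≤x) (ℕP.m≤n+m (suc x) (toℕ r))
  t≤c′ : t ≤ toℕ (punchIn (column t) c)
  t≤c′ = ℕP.≤-trans (ℕP.n≤1+n t) (ℕP.≤-reflexive (sym (trans
           (toℕ-punchIn-≥ (column t) c (ℕP.≤-reflexive (trans (toℕ-column t) (sym c≡t))))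
           (cong suc c≡t))))

det-E-step : ∀ t → det (suc (suc t)) (E (suc (suc t))) ≡ - (sgn t * det (suc t) (E (suc t)))
det-E-step t = begin
  det (suc (suc t)) (E (suc (suc t)))
    ≡⟨ det-H-reduceRow₀ (suc t) (suc (suc t)) (eWeights t) refl (column t) (λ c c≢j → eRow-≢ t c λ c≡t →
         c≢j (FinP.toℕ-injective (trans c≡t (sym (toℕ-column t))))) ⟩
  sgn (toℕ (column t)) * (eRow t (toℕ (column t)) * det (suc t) (minor (E (suc (suc t))) zero (column t)))
    ≡⟨ cong₂ (λ i D → sgn i * (eRow t i * D)) (toℕ-column t) (det-cong (suc t) (minor-E t)) ⟩
  sgn t * (eRow t t * det (suc t) (E (suc t)))
    ≡⟨ cong (λ v → sgn t * (v * det (suc t) (E (suc t)))) (eRow-t t) ⟩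
  sgn t * (- + 1 * det (suc t) (E (suc t)))
    ≡⟨ negate (sgn t) (det (suc t) (E (suc t))) ⟩
  - (sgn t * det (suc t) (E (suc t))) ∎
  where
  negate : ∀ s D → s * (- + 1 * D) ≡ - (s * D)
  negate = solve-∀

half-suc : ∀ m → suc (suc m) / 2 ≡ suc (m / 2)
half-suc m = ℕD.m/n≡1+[m∸n]/n {suc (suc m)} {2} (s≤s (s≤s z≤n))

sgn-half-step : ∀ t → sgn (suc (suc t) / 2) ≡ - (sgn t * sgn (suc t / 2))
sgn-half-step zero          = refl
sgn-half-step (suc zero)    = refl
sgn-half-step (suc (suc t)) = begin
  sgn (suc (suc (suc (suc t))) / 2)          ≡⟨ cong sgn (half-suc (suc (suc t))) ⟩
  - sgn (suc (suc t) / 2)                    ≡⟨ cong -_ (sgn-half-step t) ⟩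
  - - (sgn t * sgn (suc t / 2))              ≡⟨ flip (sgn t) (sgn (suc t / 2)) ⟩
  - (- - sgn t * - sgn (suc t / 2))          ≡⟨ cong (λ h → - (- - sgn t * sgn h)) (half-suc (suc t)) ⟨
  - (- - sgn t * sgn (suc (suc (suc t)) / 2)) ∎
  where
  flip : ∀ a b → - - (a * b) ≡ - (- - a * - b)
  flip = solve-∀

det-E : ∀ t → det (suc t) (E (suc t)) ≡ sgn (suc t / 2)
det-E zero    = refl
det-E (suc t) = begin
  det (suc (suc t)) (E (suc (suc t)))   ≡⟨ det-E-step t ⟩
  - (sgn t * det (suc t) (E (suc t)))   ≡⟨ cong (λ D → - (sgn t * D)) (det-E t) ⟩
  - (sgn t * sgn (suc t / 2))           ≡⟨ sgn-half-step t ⟨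
  sgn (suc (suc t) / 2)                 ∎

pivot : ℕ → ℤ
pivot k = + (suc (suc (suc k)) C 2) - + 1

-- The weights ρ + 1 have interior differences −1, cancelled by their sum, which the last
-- weight makes 1.
mWeights : ℕ → ℕ → ℤ
mWeights k ρ = + suc ρ - δ ρ (suc k) * pivot k

mRow : ℕ → ℕ → ℤ
mRow k = weightedRow (suc (suc k)) (suc (suc (suc k))) (mWeights k)

mWeights-≢ : ∀ k {ρ} → ρ ≢ suc k → mWeights k ρ ≡ + suc ρ
mWeights-≢ k {ρ} ρ≢ = trans (cong (λ e → + suc ρ - e * pivot k) (δ-≢ ρ≢)) (ℤP.+-identityʳ (+ suc ρ))

weightSum-mWeights : ∀ k → weightSum (suc (suc k)) (mWeights k) ≡ + 1
weightSum-mWeights k = begin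
  weightSum (suc (suc k)) (mWeights k)
    ≡⟨ weightSum-spike (suc (suc k)) (λ ρ → + suc ρ) (pivot k) ℕP.≤-refl ⟩
  weightSum (suc (suc k)) (λ ρ → + suc ρ) - pivot k
    ≡⟨ cong (_- pivot k) (weightSum-triangle (suc (suc k))) ⟩
  + (suc (suc (suc k)) C 2) - pivot k
    ≡⟨ cancel (+ (suc (suc (suc k)) C 2)) ⟩
  + 1 ∎
  where
  cancel : ∀ a → a - (a - + 1) ≡ + 1
  cancel = solve-∀

mRow-0 : ∀ k → mRow k 0 ≡ pivot k
mRow-0 k = begin
  mRow k 0
    ≡⟨ weightedRow-interior (suc (suc k)) (suc (suc (suc k))) (mWeights k) 0 k ℕP.≤-refl refl ⟩
  weightSum (suc (suc k)) (mWeights k) - mWeights k (suc k) + mWeights k k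
    ≡⟨ cong₂ (λ σ a → σ - a + mWeights k k) (weightSum-mWeights k)
                                             (cong (λ e → + suc (suc k) - e * pivot k) (δ-refl k)) ⟩
  + 1 - (+ suc (suc k) - + 1 * pivot k) + mWeights k k
    ≡⟨ cong (λ b → + 1 - (+ suc (suc k) - + 1 * pivot k) + b) (mWeights-≢ k (ℕP.<⇒≢ ℕP.≤-refl)) ⟩
  + 1 - (+ 1 + + suc k - + 1 * pivot k) + + suc k
    ≡⟨ telescope (+ suc k) (pivot k) ⟩
  pivot k ∎
  where
  telescope : ∀ m x → + 1 - (+ 1 + m - + 1 * x) + m ≡ x
  telescope = solve-∀

mRow-suc : ∀ k (c : Fin (suc k)) → mRow k (suc (toℕ c)) ≡ + 0
mRow-suc k c with ℕP.m≤n⇒m<n∨m≡n (FinP.toℕ≤pred[n] c)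
... | inj₂ c≡k = begin
  mRow k (suc (toℕ c))
    ≡⟨ weightedRow-edge (suc (suc k)) (suc (suc (suc k))) (mWeights k) (suc (toℕ c)) (s≤s z≤n)
         (cong (3 ℕ.+_) (sym c≡k)) ⟩
  weightSum (suc (suc k)) (mWeights k) - + 1
    ≡⟨ cong (_- + 1) (weightSum-mWeights k) ⟩
  + 0 ∎
... | inj₁ c<k with ℕP.m≤n⇒∃[o]m+o≡n c<k
...   | o , 1+c+o≡k = begin
  mRow k (suc (toℕ c))
    ≡⟨ weightedRow-interior (suc (suc k)) (suc (suc (suc k))) (mWeights k) (suc (toℕ c)) o
         (s≤s (ℕP.m<n⇒m<1+n o<k)) (cong (3 ℕ.+_) (sym 1+c+o≡k)) ⟩
  weightSum (suc (suc k)) (mWeights k) - mWeights k (suc o) + mWeights k o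
    ≡⟨ cong₂ (λ a b → weightSum (suc (suc k)) (mWeights k) - a + b)
         (mWeights-≢ k (ℕP.<⇒≢ (s≤s o<k))) (mWeights-≢ k (ℕP.<⇒≢ (ℕP.m<n⇒m<1+n o<k))) ⟩
  weightSum (suc (suc k)) (mWeights k) - (+ 1 + + suc o) + + suc o
    ≡⟨ cong (λ σ → σ - (+ 1 + + suc o) + + suc o) (weightSum-mWeights k) ⟩
  + 1 - (+ 1 + + suc o) + + suc o
    ≡⟨ telescope (+ suc o) ⟩
  + 0 ∎
  where
  o<k : o < k
  o<k = subst (o <_) 1+c+o≡k (s≤s (ℕP.m≤n+m o (toℕ c)))
  telescope : ∀ m → + 1 - (+ 1 + m) + m ≡ + 0
  telescope = solve-∀

minor-M : ∀ k r c → minor (M (suc (suc (suc k)))) zero zero r c ≡ E (suc k) r c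
minor-M k r c = cong (hankel (suc k)) (ℕP.+-suc (toℕ r) (suc (toℕ c)))

det-M : ∀ k → det (suc (suc k)) (M (suc (suc (suc k)))) ≡ pivot k * det (suc k) (E (suc k))
det-M k = begin
  det (suc (suc k)) (M (suc (suc (suc k))))
    ≡⟨ det-H-reduceRow₀ (suc k) (suc (suc (suc k))) (mWeights k) refl zero
         (λ { zero 0≢0 → contradiction refl 0≢0 ; (suc c) _ → mRow-suc k c }) ⟩
  + 1 * (mRow k 0 * det (suc k) (minor (M (suc (suc (suc k)))) zero zero))
    ≡⟨ ℤP.*-identityˡ _ ⟩
  mRow k 0 * det (suc k) (minor (M (suc (suc (suc k)))) zero zero)
    ≡⟨ cong₂ _*_ (mRow-0 k) (det-cong (suc k) (minor-M k)) ⟩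
  pivot k * det (suc k) (E (suc k)) ∎

mainTheorem1 : (n : ℕ) → 3 ≤ n →
    det (n ∸ 1) (M n) ≡ sgn ((n ∸ 2) / 2) * (+ (n C 2) - + 1)
mainTheorem1 (suc (suc (suc k))) (s≤s (s≤s (s≤s _))) = begin
  det (suc (suc k)) (M (suc (suc (suc k))))  ≡⟨ det-M k ⟩
  pivot k * det (suc k) (E (suc k))              ≡⟨ cong (pivot k *_) (det-E k) ⟩
  pivot k * sgn (suc k / 2)                      ≡⟨ ℤP.*-comm (pivot k) (sgn (suc k / 2)) ⟩
  sgn (suc k / 2) * pivot k                      ∎
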